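{- Let $A,B,C$ be $\sigma$-sets in a $\sigma$-set $S$, and let $\cup$ denote fusion. If $(A \cup B) \cup C = A \cup (B \cup C)$, then $\overrightarrow{ABC} = \overrightarrow{CBA}$, that is, $(A\cup B)\cup C = (C \cup B)\cup A$.
   Context: A $\sigma$-set is a collection whose members may be elements or antielements. Every element $x$ has an antielement $x^{\ast}$, with $(x^{\ast})^{\ast}=x$. For a $\sigma$-set $A$, $A^{\ast}=\{a^{\ast}: a\in A\}$. For $\sigma$-sets $X,Y$ define $X \hat{\cap} Y := \{x \in X : x^{\ast} \in Y\}$ and $X \divideontimes Y := X - (X \hat{\cap} Y)$. The fusion of $X$ and $Y$, written $X \cup Y$ (this is not ordinary union), is $X \cup Y = \{x : x \in X \divideontimes Y \text{ or } x \in Y \divideontimes X\}$. Consequently $\{x\}\cup\{x^{\ast}\}=\emptyset$ and $A \cup A^{\ast}=\emptyset$. Fusion is commutative. For $\sigma$-sets $X,Y,Z$, the chain of fusion $\overrightarrow{XYZ}$ denotes $(X\cup Y)\cup Z$. -}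

module Defs where

open import Level using (Level; _⊔_; suc)
open import Data.Product using (_×_; _,_)
open import Data.Sum using (_⊎_)
open import Relation.Nullary using (¬_)

-- Members of σ-sets over a type E of (underlying) elements:
-- each member is either an element x or its antielement x*.
data Signed {a : Level} (E : Set a) : Set a where
  el   : E → Signed E
  anti : E → Signed E

_* : {a : Level} {E : Set a} → Signed E → Signed E
el x *   = anti x
anti x * = el x

σSet : {a : Level} (ℓ : Level) (E : Set a) → Set (a ⊔ suc ℓ)
σSet ℓ E = Signed E → Set ℓ

module _ {a ℓ : Level} {E : Set a} where

  _∈_ : Signed E → σSet ℓ E → Set ℓ
  x ∈ X = X x

  _⊆_ : σSet ℓ E → σSet ℓ E → Set (a ⊔ ℓ)
  X ⊆ Y = ∀ x → x ∈ X → x ∈ Y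

  _≐_ : σSet ℓ E → σSet ℓ E → Set (a ⊔ ℓ)
  X ≐ Y = (X ⊆ Y) × (Y ⊆ X)

  _∩̂_ : σSet ℓ E → σSet ℓ E → σSet ℓ E
  (X ∩̂ Y) x = (x ∈ X) × ((x *) ∈ Y)

  _⋇_ : σSet ℓ E → σSet ℓ E → σSet ℓ E
  (X ⋇ Y) x = (x ∈ X) × ¬ (x ∈ (X ∩̂ Y))

  _∪_ : σSet ℓ E → σSet ℓ E → σSet ℓ E
  (X ∪ Y) x = (x ∈ (X ⋇ Y)) ⊎ (x ∈ (Y ⋇ X))

  infixl 6 _∪_

  chain : σSet ℓ E → σSet ℓ E → σSet ℓ E → σSet ℓ E
  chain X Y Z = (X ∪ Y) ∪ Z

module Submission where

open import Defs
open import Level using (Level)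
open import Data.Product using (_,_)
open import Data.Sum using (inj₁; inj₂)

-- Associativity links the two bracketings and commutativity of fusion does the rest:
-- (A ∪ B) ∪ C ≐ A ∪ (B ∪ C) ≐ A ∪ (C ∪ B) ≐ (C ∪ B) ∪ A.

module _ {a ℓ : Level} {E : Set a} where

  ⊆-trans : {X Y Z : σSet ℓ E} → X ⊆ Y → Y ⊆ Z → X ⊆ Z
  ⊆-trans X⊆Y Y⊆Z x x∈X = Y⊆Z x (X⊆Y x x∈X)

  ≐-sym : {X Y : σSet ℓ E} → X ≐ Y → Y ≐ X
  ≐-sym (X⊆Y , Y⊆X) = Y⊆X , X⊆Y

  ≐-trans : {X Y Z : σSet ℓ E} → X ≐ Y → Y ≐ Z → X ≐ Z
  ≐-trans (X⊆Y , Y⊆X) (Y⊆Z , Z⊆Y) = ⊆-trans X⊆Y Y⊆Z , ⊆-trans Z⊆Y Y⊆X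

  ∪-comm-⊆ : (X Y : σSet ℓ E) → (X ∪ Y) ⊆ (Y ∪ X)
  ∪-comm-⊆ X Y x (inj₁ x∈X⋇Y) = inj₂ x∈X⋇Y
  ∪-comm-⊆ X Y x (inj₂ x∈Y⋇X) = inj₁ x∈Y⋇X

  ∪-comm : (X Y : σSet ℓ E) → (X ∪ Y) ≐ (Y ∪ X)
  ∪-comm X Y = ∪-comm-⊆ X Y , ∪-comm-⊆ Y X

  -- Fusion is not monotone (a larger Y cancels more of X), so congruence needs both inclusions.
  ∪-congˡ-⊆ : (X : σSet ℓ E) {Y Y′ : σSet ℓ E} → Y ≐ Y′ → (X ∪ Y) ⊆ (X ∪ Y′)
  ∪-congˡ-⊆ X (Y⊆Y′ , Y′⊆Y) x (inj₁ (x∈X , x∉X∩̂Y)) =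
    inj₁ (x∈X , λ { (x∈X , x*∈Y′) → x∉X∩̂Y (x∈X , Y′⊆Y _ x*∈Y′) })
  ∪-congˡ-⊆ X (Y⊆Y′ , Y′⊆Y) x (inj₂ (x∈Y , x∉Y∩̂X)) =
    inj₂ (Y⊆Y′ x x∈Y , λ { (x∈Y′ , x*∈X) → x∉Y∩̂X (Y′⊆Y x x∈Y′ , x*∈X) })

  ∪-congˡ : (X : σSet ℓ E) {Y Y′ : σSet ℓ E} → Y ≐ Y′ → (X ∪ Y) ≐ (X ∪ Y′)
  ∪-congˡ X Y≐Y′ = ∪-congˡ-⊆ X Y≐Y′ , ∪-congˡ-⊆ X (≐-sym Y≐Y′)

lemma3p3 : {a ℓ : Level} {E : Set a} (S A B C : σSet ℓ E) →
    A ⊆ S → B ⊆ S → C ⊆ S →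
    ((A ∪ B) ∪ C) ≐ (A ∪ (B ∪ C)) →
    chain A B C ≐ chain C B A
lemma3p3 S A B C _ _ _ assoc =
  ≐-trans assoc (≐-trans (∪-congˡ A (∪-comm B C)) (∪-comm A (C ∪ B)))
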